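{- For all integers $0 \leq m < n-1$, the Hasse diagram of the subposet $Q=\{x \in P_{n,m} : \mathrm{sgn}(e_1) \leq x\}$ admits an acyclic perfect matching, where $e_1$ is the first standard basis vector of $\mathbb{R}^n$ (so $\mathrm{sgn}(e_1)=(+,0,\dots,0)$).
   Context: For $v\in\mathbb{R}^n$, $\mathrm{sgn}(v)\in\{ -,0,+\}^n$ is the vector of signs of its entries, considered up to global negation. The sign variation $\mathrm{var}$ of a vector or sign vector is the number of sign changes after deleting zero entries. $P_{n,m}$ is the poset of nonzero sign vectors $\omega\in\{ -,0,+\}^n$ (up to global negation) with $\mathrm{var}(\omega)\le m$, ordered by $\omega'\leq\omega$ iff $\omega'$ is obtained from $\omega$ by replacing some nonzero entries by $0$. The Hasse diagram of a poset is regarded as a directed graph with an edge $b\to a$ for each cover relation $a\lessdot b$. A matching of the Hasse diagram is acyclic if reversing the orientation of every matched edge yields a directed acyclic graph; it is perfect if every element is matched. -}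

module Defs where

open import Level using (Level; _⊔_) renaming (suc to lsuc)
open import Data.Nat using (ℕ; zero; suc; _≤_)
open import Data.Bool using (Bool; true; false; T)
open import Data.Vec using (Vec; []; _∷_; replicate; map)
open import Data.Vec.Relation.Binary.Pointwise.Inductive using (Pointwise)
open import Data.Product using (Σ; _×_; proj₁; ∃)
open import Data.Sum using (_⊎_)
open import Relation.Binary.PropositionalEquality using (_≡_; _≢_)
open import Relation.Nullary using (¬_)

data Sign : Set where
  minus zer plus : Sign

negS : Sign → Sign
negS minus = plus
negS zer   = zer
negS plus  = minus

negate : ∀ {n} → Vec Sign n → Vec Sign n
negate = map negS

-- Sign variation: number of sign changes after deleting zero entries.
-- The first argument is the last nonzero sign seen so far (zer = none yet).
varFrom : ∀ {k} → Sign → Vec Sign k → ℕ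
varFrom p     []            = 0
varFrom p     (zer   ∷ xs)  = varFrom p xs
varFrom zer   (plus  ∷ xs)  = varFrom plus xs
varFrom zer   (minus ∷ xs)  = varFrom minus xs
varFrom plus  (plus  ∷ xs)  = varFrom plus xs
varFrom plus  (minus ∷ xs)  = suc (varFrom minus xs)
varFrom minus (minus ∷ xs)  = varFrom minus xs
varFrom minus (plus  ∷ xs)  = suc (varFrom plus xs)

var : ∀ {n} → Vec Sign n → ℕ
var = varFrom zer

-- Sign vectors are taken up to global negation; we represent each class
-- {ω, -ω} of a NONZERO sign vector by its unique member whose first
-- nonzero entry is plus.  (isCanonical is false for the zero vector.)
isCanonical : ∀ {n} → Vec Sign n → Bool
isCanonical []           = false
isCanonical (zer   ∷ xs) = isCanonical xs
isCanonical (plus  ∷ _)  = true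
isCanonical (minus ∷ _)  = false

data _⊑_ : Sign → Sign → Set where
  0⊑  : ∀ {s} → zer ⊑ s
  +⊑+ : plus ⊑ plus
  -⊑- : minus ⊑ minus

_≼_ : ∀ {n} → Vec Sign n → Vec Sign n → Set
_≼_ = Pointwise _⊑_

_≤ₛ_ : ∀ {n} → Vec Sign n → Vec Sign n → Set
ω' ≤ₛ ω = (ω' ≼ ω) ⊎ (negate ω' ≼ ω)

P : ℕ → ℕ → Set
P n m = Σ (Vec Sign n) (λ ω → T (isCanonical ω) × (var ω ≤ m))

sgnE1 : (n : ℕ) → Vec Sign n
sgnE1 zero    = []
sgnE1 (suc k) = plus ∷ replicate k zer

Q : ℕ → ℕ → Set
Q n m = Σ (P n m) (λ x → sgnE1 n ≤ₛ proj₁ x)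

vecQ : ∀ {n m} → Q n m → Vec Sign n
vecQ x = proj₁ (proj₁ x)

_≤Q_ : ∀ {n m} → Q n m → Q n m → Set
a ≤Q b = vecQ a ≤ₛ vecQ b

_<Q_ : ∀ {n m} → Q n m → Q n m → Set
a <Q b = (a ≤Q b) × (a ≢ b)

_⋖Q_ : ∀ {n m} → Q n m → Q n m → Set
a ⋖Q b = (a <Q b) × (∀ c → ¬ ((a <Q c) × (c <Q b)))

-- Matchings of a Hasse diagram (given by its cover relation _⋖_;
-- the diagram has an edge b → a for each a ⋖ b)

data Plus {a ℓ} {A : Set a} (E : A → A → Set ℓ) : A → A → Set (a ⊔ ℓ) where
  [_]  : ∀ {x y} → E x y → Plus E x y
  _∷⁺_ : ∀ {x y z} → E x y → Plus E y z → Plus E x z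

module _ {a ℓ} {A : Set a} (_⋖_ : A → A → Set ℓ) where

  -- M a b : the Hasse edge b → a (with a ⋖ b) is in the matching
  record IsMatching {ℓ'} (M : A → A → Set ℓ') : Set (a ⊔ ℓ ⊔ ℓ') where
    field
      edge     : ∀ {x y} → M x y → x ⋖ y
      disjoint : ∀ {x y u v} → M x y → M u v →
                 (x ≡ u) ⊎ (x ≡ v) ⊎ (y ≡ u) ⊎ (y ≡ v) →
                 (x ≡ u) × (y ≡ v)

  IsPerfect : ∀ {ℓ'} → (A → A → Set ℓ') → Set (a ⊔ ℓ')
  IsPerfect M = ∀ x → ∃ λ y → M x y ⊎ M y x

  Reversed : ∀ {ℓ'} → (A → A → Set ℓ') → A → A → Set (ℓ ⊔ ℓ')
  Reversed M u v = ((v ⋖ u) × ¬ M v u) ⊎ M u v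

  IsAcyclic : ∀ {ℓ'} → (A → A → Set ℓ') → Set (a ⊔ ℓ ⊔ ℓ')
  IsAcyclic M = ∀ x → ¬ Plus (Reversed M) x x

  HasAcyclicPerfectMatching : Set (a ⊔ ℓ ⊔ lsuc a)
  HasAcyclicPerfectMatching =
    Σ (A → A → Set a) λ M → IsMatching M × IsPerfect M × IsAcyclic M

module Submission where

-- Every element of Q = {x ∈ P_{n,m} : sgn(e₁) ≤ x} with n = k + 1 is the
-- canonical sign vector (+ ∷ ws) for a unique tail ws ∈ {-,0,+}^k with
-- var(+ ∷ ws) ≤ m, and the order of Q is the zeroing order ≼ on tails.
--
-- The matching toggles one entry of the tail.  Scan ws while its entries
-- keep changing sign with respect to the last nonzero sign seen (starting
-- from +); the first entry that is 0 or repeats that last sign is the pivot,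
-- and the matching pairs "pivot = 0" with "pivot = last sign".  This keeps
-- var unchanged and is an involution (Toggle below).  A tail without pivot
-- alternates completely, so var = k > m: the matching is perfect.
--
-- Acyclicity: the potential (length of the alternating prefix, weight of the
-- rest plus 2 if the pivot is 0) strictly decreases, lexicographically, along
-- every matched up-edge and every unmatched cover (descent).

open import Defs
open import Data.Nat using (ℕ; zero; suc; _<_; _≤_; z≤n; s≤s)
open import Data.Nat.Properties
  using (≤-irrelevant; <-trans; <-irrefl; <-resp₂-≡; ≤-trans; n≤1+n; n<1+n)
open import Data.Bool using (Bool; true; false; not)
open import Data.Unit using (tt)
open import Data.Empty using (⊥-elim)
open import Data.Vec using (Vec; []; _∷_; replicate; tail)
open import Data.Vec.Relation.Binary.Pointwise.Inductive using ([]; _∷_)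
import Data.Vec.Relation.Binary.Pointwise.Inductive as Pointwise
open import Data.Product using (_×_; _,_; proj₁; proj₂; ∃)
import Data.Product as Product
open import Data.Product.Relation.Binary.Lex.Strict
  using (×-Lex; ×-transitive; ×-irreflexive)
open import Data.Sum using (_⊎_; inj₁; inj₂)
import Data.Sum as Sum
open import Relation.Binary using (Transitive)
open import Relation.Binary.PropositionalEquality
open import Relation.Nullary using (¬_)

⊑-refl : ∀ s → s ⊑ s
⊑-refl minus = -⊑-
⊑-refl zer   = 0⊑
⊑-refl plus  = +⊑+

≼-refl : ∀ {k} {xs : Vec Sign k} → xs ≼ xs
≼-refl = Pointwise.refl (⊑-refl _)

⊑-antisym : ∀ {s t} → s ⊑ t → t ⊑ s → s ≡ t
⊑-antisym 0⊑  0⊑ = refl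
⊑-antisym +⊑+ _  = refl
⊑-antisym -⊑- _  = refl

≼-antisym : ∀ {k} {xs ys : Vec Sign k} → xs ≼ ys → ys ≼ xs → xs ≡ ys
≼-antisym []       []       = refl
≼-antisym (p ∷ ps) (q ∷ qs) = cong₂ _∷_ (⊑-antisym p q) (≼-antisym ps qs)

-- ≼ is proof-irrelevant; needed to identify elements of Q by their vectors.
≼-irrelevant : ∀ {k} {xs ys : Vec Sign k} (p q : xs ≼ ys) → p ≡ q
≼-irrelevant []       []       = refl
≼-irrelevant (p ∷ ps) (q ∷ qs) = cong₂ _∷_ (⊑-irrelevant p q) (≼-irrelevant ps qs)
  where
  ⊑-irrelevant : ∀ {s t} (p q : s ⊑ t) → p ≡ q
  ⊑-irrelevant 0⊑  0⊑  = refl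
  ⊑-irrelevant +⊑+ +⊑+ = refl
  ⊑-irrelevant -⊑- -⊑- = refl

zeros≼ : ∀ {k} (ws : Vec Sign k) → replicate k zer ≼ ws
zeros≼ []       = []
zeros≼ (_ ∷ ws) = 0⊑ ∷ zeros≼ ws

weight : ∀ {k} → Vec Sign k → ℕ
weight []          = 0
weight (zer   ∷ r) = weight r
weight (plus  ∷ r) = suc (weight r)
weight (minus ∷ r) = suc (weight r)

weight-mono : ∀ {k} {xs ys : Vec Sign k} → xs ≼ ys → weight xs ≤ weight ys
weight-mono []                = z≤n
weight-mono (0⊑ {zer}   ∷ p) = weight-mono p
weight-mono (0⊑ {plus}  ∷ p) = ≤-trans (weight-mono p) (n≤1+n _)
weight-mono (0⊑ {minus} ∷ p) = ≤-trans (weight-mono p) (n≤1+n _)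
weight-mono (+⊑+        ∷ p) = s≤s (weight-mono p)
weight-mono (-⊑-        ∷ p) = s≤s (weight-mono p)

weight-strict : ∀ {k} {xs ys : Vec Sign k} → xs ≼ ys → xs ≢ ys →
                weight xs < weight ys
weight-strict []                ne = ⊥-elim (ne refl)
weight-strict (0⊑ {zer}   ∷ p) ne = weight-strict p (λ e → ne (cong (zer ∷_) e))
weight-strict (0⊑ {plus}  ∷ p) ne = s≤s (weight-mono p)
weight-strict (0⊑ {minus} ∷ p) ne = s≤s (weight-mono p)
weight-strict (+⊑+        ∷ p) ne = s≤s (weight-strict p (λ e → ne (cong (plus ∷_) e)))
weight-strict (-⊑-        ∷ p) ne = s≤s (weight-strict p (λ e → ne (cong (minus ∷_) e)))

sg : Bool → Sign
sg true  = plus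
sg false = minus

-- Toggle b xs ys: the last nonzero sign before xs is sg b; skipping the
-- entries of xs that change sign, the first remaining entry (the pivot) is
-- 0 in xs and sg b in ys, all other entries agree.
data Toggle : ∀ {k} → Bool → Vec Sign k → Vec Sign k → Set where
  fill : ∀ {b k} {xs : Vec Sign k} → Toggle b (zer ∷ xs) (sg b ∷ xs)
  skip : ∀ {b k} {xs ys : Vec Sign k} → Toggle (not b) xs ys →
         Toggle b (sg (not b) ∷ xs) (sg (not b) ∷ ys)

toggle-≼ : ∀ {k b} {xs ys : Vec Sign k} → Toggle b xs ys → xs ≼ ys
toggle-≼ fill         = 0⊑ ∷ ≼-refl
toggle-≼ (skip {b} t) = ⊑-refl (sg (not b)) ∷ toggle-≼ t

toggle-≢ : ∀ {k b} {xs ys : Vec Sign k} → Toggle b xs ys → xs ≢ ys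
toggle-≢ {b = true}  fill ()
toggle-≢ {b = false} fill ()
toggle-≢ (skip t) e = toggle-≢ t (cong tail e)

toggle-var : ∀ {k b} {xs ys : Vec Sign k} → Toggle b xs ys →
             varFrom (sg b) xs ≡ varFrom (sg b) ys
toggle-var {b = true}  fill     = refl
toggle-var {b = false} fill     = refl
toggle-var {b = true}  (skip t) = cong suc (toggle-var t)
toggle-var {b = false} (skip t) = cong suc (toggle-var t)

toggle-functional : ∀ {k b} {xs ys ys' : Vec Sign k} →
                    Toggle b xs ys → Toggle b xs ys' → ys ≡ ys'
toggle-functional {b = true}  fill     fill      = refl
toggle-functional {b = false} fill     fill      = refl
toggle-functional {b = true}  (skip t) (skip t') = cong (minus ∷_) (toggle-functional t t')
toggle-functional {b = false} (skip t) (skip t') = cong (plus ∷_) (toggle-functional t t')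

toggle-injective : ∀ {k b} {xs xs' ys : Vec Sign k} →
                   Toggle b xs ys → Toggle b xs' ys → xs ≡ xs'
toggle-injective {b = true}  fill     fill      = refl
toggle-injective {b = false} fill     fill      = refl
toggle-injective {b = true}  (skip t) (skip t') = cong (minus ∷_) (toggle-injective t t')
toggle-injective {b = false} (skip t) (skip t') = cong (plus ∷_) (toggle-injective t t')

toggle-no-chain : ∀ {k b} {xs ys zs : Vec Sign k} →
                  Toggle b xs ys → ¬ Toggle b zs xs
toggle-no-chain {b = true}  fill     ()
toggle-no-chain {b = false} fill     ()
toggle-no-chain {b = true}  (skip t) (skip t') = toggle-no-chain t t'
toggle-no-chain {b = false} (skip t) (skip t') = toggle-no-chain t t'

toggle-tight : ∀ {k b} {xs ys cs : Vec Sign k} → Toggle b xs ys →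
               xs ≼ cs → cs ≼ ys → (cs ≡ xs) ⊎ (cs ≡ ys)
toggle-tight {b = true}  fill (0⊑ ∷ p) (0⊑  ∷ q) = inj₁ (cong (zer ∷_) (≼-antisym q p))
toggle-tight {b = true}  fill (0⊑ ∷ p) (+⊑+ ∷ q) = inj₂ (cong (plus ∷_) (≼-antisym q p))
toggle-tight {b = false} fill (0⊑ ∷ p) (0⊑  ∷ q) = inj₁ (cong (zer ∷_) (≼-antisym q p))
toggle-tight {b = false} fill (0⊑ ∷ p) (-⊑- ∷ q) = inj₂ (cong (minus ∷_) (≼-antisym q p))
toggle-tight {b = true}  (skip t) (-⊑- ∷ p) (-⊑- ∷ q) =
  Sum.map (cong (minus ∷_)) (cong (minus ∷_)) (toggle-tight t p q)
toggle-tight {b = false} (skip t) (+⊑+ ∷ p) (+⊑+ ∷ q) =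
  Sum.map (cong (plus ∷_)) (cong (plus ∷_)) (toggle-tight t p q)

toggle-partner : ∀ {k} b (ws : Vec Sign k) → varFrom (sg b) ws < k →
                 ∃ λ ys → Toggle b ws ys ⊎ Toggle b ys ws
toggle-partner b     []          ()
toggle-partner b     (zer   ∷ r) _ = sg b ∷ r , inj₁ fill
toggle-partner true  (plus  ∷ r) _ = zer ∷ r , inj₂ fill
toggle-partner false (minus ∷ r) _ = zer ∷ r , inj₂ fill
toggle-partner true  (minus ∷ r) (s≤s h) =
  Product.map (minus ∷_) (Sum.map skip skip) (toggle-partner false r h)
toggle-partner false (plus  ∷ r) (s≤s h) =
  Product.map (plus ∷_) (Sum.map skip skip) (toggle-partner true r h)

_<ₗₑₓ_ : ℕ × ℕ → ℕ × ℕ → Set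
_<ₗₑₓ_ = ×-Lex _≡_ _<_ _<_

<ₗₑₓ-trans : Transitive _<ₗₑₓ_
<ₗₑₓ-trans = ×-transitive {_≈₁_ = _≡_} {_<₁_ = _<_} {_<₂_ = _<_} isEquivalence <-resp₂-≡ <-trans <-trans

<ₗₑₓ-irrefl : ∀ {p} → ¬ p <ₗₑₓ p
<ₗₑₓ-irrefl {p} =
  ×-irreflexive {_≈₁_ = _≡_} {_<₁_ = _<_} {_≈₂_ = _≡_} {_<₂_ = _<_}
    <-irrefl <-irrefl {p} {p} (refl , refl)

extend : ℕ × ℕ → ℕ × ℕ
extend p = suc (proj₁ p) , proj₂ p

extend-mono : ∀ {p q} → p <ₗₑₓ q → extend p <ₗₑₓ extend q
extend-mono (inj₁ j<j')          = inj₁ (s≤s j<j')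
extend-mono (inj₂ (refl , w<w')) = inj₂ (refl , w<w')

-- (length of the alternating prefix, weight after it plus 2 if the pivot is 0)
potential : ∀ {k} → Bool → Vec Sign k → ℕ × ℕ
potential b     []          = 0 , 0
potential b     (zer   ∷ r) = 0 , suc (suc (weight r))
potential true  (plus  ∷ r) = 0 , suc (weight r)
potential true  (minus ∷ r) = extend (potential false r)
potential false (minus ∷ r) = 0 , suc (weight r)
potential false (plus  ∷ r) = extend (potential true r)

toggle-descends : ∀ {k b} {xs ys : Vec Sign k} → Toggle b xs ys →
                  potential b ys <ₗₑₓ potential b xs
toggle-descends {b = true}  fill     = inj₂ (refl , n<1+n _)
toggle-descends {b = false} fill     = inj₂ (refl , n<1+n _)
toggle-descends {b = true}  (skip t) = extend-mono (toggle-descends t)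
toggle-descends {b = false} (skip t) = extend-mono (toggle-descends t)

descent : ∀ {k} b {ws us : Vec Sign k} → ws ≼ us → ws ≢ us →
          potential b ws <ₗₑₓ potential b us ⊎ ∃ λ cs → Toggle b ws cs × cs ≼ us
descent b     []                ne = ⊥-elim (ne refl)
descent b     (0⊑ {zer}   ∷ p) ne =
  inj₁ (inj₂ (refl , s≤s (s≤s (weight-strict p (λ e → ne (cong (zer ∷_) e))))))
descent true  (0⊑ {plus}  ∷ p) ne = inj₂ (_ , fill , +⊑+ ∷ p)
descent false (0⊑ {minus} ∷ p) ne = inj₂ (_ , fill , -⊑- ∷ p)
descent true  (0⊑ {minus} ∷ p) ne = inj₁ (inj₁ (s≤s z≤n))
descent false (0⊑ {plus}  ∷ p) ne = inj₁ (inj₁ (s≤s z≤n))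
descent true  (+⊑+ ∷ p) ne =
  inj₁ (inj₂ (refl , s≤s (weight-strict p (λ e → ne (cong (plus ∷_) e)))))
descent false (-⊑- ∷ p) ne =
  inj₁ (inj₂ (refl , s≤s (weight-strict p (λ e → ne (cong (minus ∷_) e)))))
descent true  (-⊑- ∷ p) ne =
  Sum.map extend-mono (Product.map (minus ∷_) (Product.map skip (-⊑- ∷_)))
          (descent false p (λ e → ne (cong (minus ∷_) e)))
descent false (+⊑+ ∷ p) ne =
  Sum.map extend-mono (Product.map (plus ∷_) (Product.map skip (+⊑+ ∷_)))
          (descent true p (λ e → ne (cong (plus ∷_) e)))

potential-forbids-cycles :
  ∀ {a b r ℓ} {A : Set a} {B : Set b} {R : A → A → Set r} {_≺_ : B → B → Set ℓ} →
  Transitive _≺_ → (∀ {p} → ¬ p ≺ p) →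
  (f : A → B) → (∀ {u v} → R u v → f v ≺ f u) → ∀ x → ¬ Plus R x x
potential-forbids-cycles {R = R} {_≺_} ≺-trans ≺-irrefl f decreases x cycle =
  ≺-irrefl (walk-descends cycle)
  where
  walk-descends : ∀ {u v} → Plus R u v → f v ≺ f u
  walk-descends [ e ]      = decreases e
  walk-descends (e ∷⁺ es) = ≺-trans (walk-descends es) (decreases e)

module TogglingMatching (k m : ℕ) where

  rest : Q (suc k) m → Vec Sign k
  rest x = tail (vecQ x)

  element : (ws : Vec Sign k) → varFrom plus ws ≤ m → Q (suc k) m
  element ws v = (plus ∷ ws , tt , v) , inj₁ (+⊑+ ∷ zeros≼ ws)

  -- sgn(e₁) ≤ x together with canonicity forces the first entry to be +
  rest-var : (x : Q (suc k) m) → varFrom plus (rest x) ≤ m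
  rest-var ((plus  ∷ ws , _  , v) , _)            = v
  rest-var ((zer   ∷ ws , _  , v) , inj₁ (() ∷ _))
  rest-var ((zer   ∷ ws , _  , v) , inj₂ (() ∷ _))
  rest-var ((minus ∷ ws , () , v) , _)

  element-rest : (x : Q (suc k) m) → x ≡ element (rest x) (rest-var x)
  element-rest ((plus ∷ ws , tt , v) , inj₁ (+⊑+ ∷ p)) =
    cong (λ q → (plus ∷ ws , tt , v) , inj₁ (+⊑+ ∷ q)) (≼-irrelevant p (zeros≼ ws))
  element-rest ((plus  ∷ ws , _  , v) , inj₂ (() ∷ _))
  element-rest ((zer   ∷ ws , _  , v) , inj₁ (() ∷ _))
  element-rest ((zer   ∷ ws , _  , v) , inj₂ (() ∷ _))
  element-rest ((minus ∷ ws , () , v) , _)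

  rest-injective : ∀ {x y} → rest x ≡ rest y → x ≡ y
  rest-injective {x} {y} e = begin
    x                             ≡⟨ element-rest x ⟩
    element (rest x) (rest-var x) ≡⟨ element-cong e ⟩
    element (rest y) (rest-var y) ≡⟨ element-rest y ⟨
    y                             ∎
    where
    open ≡-Reasoning
    element-cong : ∀ {ws us} {v v'} → ws ≡ us → element ws v ≡ element us v'
    element-cong {v = v} {v'} refl = cong (element _) (≤-irrelevant v v')

  vec-rest : (x : Q (suc k) m) → vecQ x ≡ plus ∷ rest x
  vec-rest x = cong vecQ (element-rest x)

  ≤Q⇒≼ : ∀ {x y} → x ≤Q y → rest x ≼ rest y
  ≤Q⇒≼ {x} {y} le with subst₂ _≤ₛ_ (vec-rest x) (vec-rest y) le
  ... | inj₁ (_ ∷ p) = p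
  ... | inj₂ (() ∷ _)

  ≼⇒≤Q : ∀ {x y} → rest x ≼ rest y → x ≤Q y
  ≼⇒≤Q {x} {y} p = subst₂ _≤ₛ_ (sym (vec-rest x)) (sym (vec-rest y)) (inj₁ (+⊑+ ∷ p))

  Matched : Q (suc k) m → Q (suc k) m → Set
  Matched x y = Toggle true (rest x) (rest y)

  matched-< : ∀ {x y} → Matched x y → x <Q y
  matched-< {x} {y} t = ≼⇒≤Q {x} {y} (toggle-≼ t) , λ e → toggle-≢ t (cong rest e)

  matched-cover : ∀ {x y} → Matched x y → x ⋖Q y
  matched-cover {x} {y} t = matched-< {x} {y} t , nothing-between
    where
    nothing-between : ∀ c → ¬ ((x <Q c) × (c <Q y))
    nothing-between c ((x≤c , x≢c) , (c≤y , c≢y))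
      with toggle-tight t (≤Q⇒≼ {x} {c} x≤c) (≤Q⇒≼ {c} {y} c≤y)
    ... | inj₁ c≡x = x≢c (sym (rest-injective c≡x))
    ... | inj₂ c≡y = c≢y (rest-injective c≡y)

  matched-disjoint : ∀ {x y u v} → Matched x y → Matched u v →
                     (x ≡ u) ⊎ (x ≡ v) ⊎ (y ≡ u) ⊎ (y ≡ v) → (x ≡ u) × (y ≡ v)
  matched-disjoint s t (inj₁ refl)                = refl , rest-injective (toggle-functional s t)
  matched-disjoint s t (inj₂ (inj₁ refl))         = ⊥-elim (toggle-no-chain s t)
  matched-disjoint s t (inj₂ (inj₂ (inj₁ refl)))  = ⊥-elim (toggle-no-chain t s)
  matched-disjoint s t (inj₂ (inj₂ (inj₂ refl)))  = rest-injective (toggle-injective s t) , refl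

  -- for m < k every tail has a partner, which lies in Q since var is kept
  matched-perfect : m < k → ∀ x → ∃ λ y → Matched x y ⊎ Matched y x
  matched-perfect m<k x with toggle-partner true (rest x) (≤-trans (s≤s (rest-var x)) m<k)
  ... | ys , inj₁ t = element ys (subst (_≤ m) (toggle-var t) (rest-var x)) , inj₁ t
  ... | ys , inj₂ t = element ys (subst (_≤ m) (sym (toggle-var t)) (rest-var x)) , inj₂ t

  reversed-descends : ∀ {u v} → Reversed _⋖Q_ Matched u v →
                      potential true (rest v) <ₗₑₓ potential true (rest u)
  reversed-descends (inj₂ t) = toggle-descends t
  reversed-descends {u} {v} (inj₁ (((v≤u , v≢u) , is-cover) , unmatched))
    with descent true (≤Q⇒≼ {v} {u} v≤u) (λ e → v≢u (rest-injective e))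
  ... | inj₁ lower = lower
  ... | inj₂ (cs , t , cs≼u) = ⊥-elim (is-cover c (matched-< {v} {c} t , c≤u , c≢u))
    where
    c : Q (suc k) m
    c = element cs (subst (_≤ m) (toggle-var t) (rest-var v))
    c≤u : c ≤Q u
    c≤u = ≼⇒≤Q {c} {u} cs≼u
    c≢u : c ≢ u
    c≢u refl = unmatched t

  matched-acyclic : IsAcyclic _⋖Q_ Matched
  matched-acyclic = potential-forbids-cycles {_≺_ = _<ₗₑₓ_} <ₗₑₓ-trans <ₗₑₓ-irrefl
                      (λ x → potential true (rest x)) reversed-descends

lemma3p5 : (n m : ℕ) → suc m < n →
    HasAcyclicPerfectMatching (_⋖Q_ {n} {m})
lemma3p5 zero    m ()
lemma3p5 (suc k) m (s≤s m<k) =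
  Matched , record { edge = matched-cover ; disjoint = matched-disjoint }
          , matched-perfect m<k , matched-acyclic
  where open TogglingMatching k m
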